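{- Let $G$ be a graph, let $u\in V(G)$, and let $k\ge 3$. Then $G\in\mathcal F_{\chi,k}$ if and only if $G_u\bowtie K_k\in\mathcal F_{(k,2)}$.
   Context: All graphs are finite, simple and without isolated vertices. $\chi(G)$ is the chromatic number. ${\rm es}_{\chi}(G)$ is the minimum number of edges of $G$ whose removal results in a spanning subgraph $G_1$ with $\chi(G_1)=\chi(G)-1$. $\mathcal F_{(k,2)}$ is the class of $(k,2)$-critical graphs, i.e. graphs $G$ with $\chi(G)=k$, ${\rm es}_{\chi}(G)=2$ and ${\rm es}_{\chi}(G-e)<{\rm es}_{\chi}(G)$ for every edge $e$. $\mathcal F_{\chi,k}$ is the class of graphs $G$ with $\chi(G)=k$ that are critical for the chromatic number, i.e. $\chi(H)<k$ for every proper subgraph $H$ of $G$ (equivalently, for isolate-free $G$, $\chi(G-e)=k-1$ for every edge $e$). $G_u\bowtie K_k$ denotes the graph obtained from the disjoint union of $G$ and a complete graph $K_k$ by identifying $u$ with a vertex of $K_k$. -}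

module Defs where

open import Data.Nat using (ℕ; zero; suc; _+_; _∸_; _≤_; _<_)
open import Data.Nat.Properties using (_<?_)
open import Data.Fin using (Fin; toℕ; splitAt; _≟_)
open import Data.Bool using (Bool; true; false; _∧_; _∨_; not; if_then_else_)
open import Data.Bool.Properties using (∧-comm; ∨-comm)
open import Data.Sum using (_⊎_; inj₁; inj₂)
open import Data.Product using (Σ; ∃; ∃-syntax; _×_; _,_)
open import Data.List using (List; map; allFin)
open import Data.Nat.ListAction using (sum)
open import Relation.Nullary using (¬_; yes; no)
open import Relation.Nullary.Decidable using (⌊_⌋)
open import Relation.Binary.PropositionalEquality using (_≡_; _≢_; refl; cong; cong₂; sym)

record Graph (n : ℕ) : Set where
  field
    adj     : Fin n → Fin n → Bool
    adj-sym : ∀ x y → adj x y ≡ adj y x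
    adj-irr : ∀ x → adj x x ≡ false
open Graph public

NoIsolated : ∀ {n} → Graph n → Set
NoIsolated {n} G = ∀ (x : Fin n) → ∃[ y ] adj G x y ≡ true

Colorable : ∀ {n} → Graph n → ℕ → Set
Colorable {n} G k =
  Σ (Fin n → Fin k) λ c → ∀ (x y : Fin n) → adj G x y ≡ true → c x ≢ c y

ChromNum : ∀ {n} → Graph n → ℕ → Set
ChromNum G k = Colorable G k × (∀ m → Colorable G m → k ≤ m)

edgeCount : ∀ {n} → Graph n → ℕ
edgeCount {n} G =
  sum (map (λ i → sum (map (λ j → if ⌊ toℕ i <? toℕ j ⌋ ∧ adj G i j then 1 else 0)
                           (allFin n)))
           (allFin n))

SpanningSub : ∀ {n} → Graph n → Graph n → Set
SpanningSub {n} H G = ∀ (x y : Fin n) → adj H x y ≡ true → adj G x y ≡ true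

removed : ∀ {n} → Graph n → Graph n → ℕ
removed G H = edgeCount G ∸ edgeCount H

EsChi : ∀ {n} → Graph n → ℕ → Set
EsChi {n} G s = ∃[ k ] (ChromNum G k ×
  (∃[ H ] (SpanningSub H G × ChromNum H (k ∸ 1) × removed G H ≡ s)) ×
  (∀ (H : Graph n) → SpanningSub H G → ChromNum H (k ∸ 1) → s ≤ removed G H))

isPair : ∀ {n} → Fin n → Fin n → Fin n → Fin n → Bool
isPair a b x y = (⌊ x ≟ a ⌋ ∧ ⌊ y ≟ b ⌋) ∨ (⌊ x ≟ b ⌋ ∧ ⌊ y ≟ a ⌋)

isPair-sym : ∀ {n} (a b x y : Fin n) → isPair a b x y ≡ isPair a b y x
isPair-sym a b x y
  rewrite ∧-comm ⌊ x ≟ a ⌋ ⌊ y ≟ b ⌋ | ∧-comm ⌊ x ≟ b ⌋ ⌊ y ≟ a ⌋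
  = ∨-comm (⌊ y ≟ b ⌋ ∧ ⌊ x ≟ a ⌋) (⌊ y ≟ a ⌋ ∧ ⌊ x ≟ b ⌋)

deleteEdge : ∀ {n} → Graph n → Fin n → Fin n → Graph n
deleteEdge G a b = record
  { adj     = λ x y → adj G x y ∧ not (isPair a b x y)
  ; adj-sym = λ x y → cong₂ _∧_ (adj-sym G x y) (cong not (isPair-sym a b x y))
  ; adj-irr = λ x → irr x
  }
  where
  irr : ∀ x → adj G x x ∧ not (isPair a b x x) ≡ false
  irr x rewrite adj-irr G x = refl

-- G ∈ F_{χ,k} (edge-critical form, as in the context for isolate-free G):
-- χ(G) = k and χ(G - e) = k - 1 for every edge e
InFchi : ℕ → ∀ {n} → Graph n → Set
InFchi k {n} G = ChromNum G k ×
  (∀ (a b : Fin n) → adj G a b ≡ true → ChromNum (deleteEdge G a b) (k ∸ 1))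

InFk2 : ℕ → ∀ {n} → Graph n → Set
InFk2 k {n} G = ChromNum G k × EsChi G 2 ×
  (∀ (a b : Fin n) → adj G a b ≡ true →
     ∃[ s ] (EsChi (deleteEdge G a b) s × s < 2))

-- G_u ⋈ K_k : vertices Fin (n + (k - 1)); the first n are V(G), the
-- remaining k - 1 together with u form the clique K_k.
joinAdj : ∀ {n m} → (Fin n → Fin n → Bool) → Fin n → Fin n ⊎ Fin m → Fin n ⊎ Fin m → Bool
joinAdj A u (inj₁ a) (inj₁ b) = A a b
joinAdj A u (inj₁ a) (inj₂ y) = ⌊ a ≟ u ⌋
joinAdj A u (inj₂ x) (inj₁ b) = ⌊ b ≟ u ⌋
joinAdj A u (inj₂ x) (inj₂ y) = not ⌊ x ≟ y ⌋

joinAdj-sym : ∀ {n m} (G : Graph n) u (p q : Fin n ⊎ Fin m) →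
  joinAdj (adj G) u p q ≡ joinAdj (adj G) u q p
joinAdj-sym G u (inj₁ a) (inj₁ b) = adj-sym G a b
joinAdj-sym G u (inj₁ a) (inj₂ y) = refl
joinAdj-sym G u (inj₂ x) (inj₁ b) = refl
joinAdj-sym G u (inj₂ x) (inj₂ y) with x ≟ y | y ≟ x
... | yes _ | yes _ = refl
... | no _  | no _  = refl
... | yes p | no ¬q = Data.Empty.⊥-elim (¬q (sym p))
  where import Data.Empty
... | no ¬p | yes q = Data.Empty.⊥-elim (¬p (sym q))
  where import Data.Empty

joinAdj-irr : ∀ {n m} (G : Graph n) u (p : Fin n ⊎ Fin m) → joinAdj (adj G) u p p ≡ false
joinAdj-irr G u (inj₁ a) = adj-irr G a
joinAdj-irr G u (inj₂ x) with x ≟ x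
... | yes _ = refl
... | no ¬p = Data.Empty.⊥-elim (¬p refl)
  where import Data.Empty

join : ∀ {n} → Graph n → Fin n → (k : ℕ) → Graph (n + (k ∸ 1))
join {n} G u k = record
  { adj     = λ x y → joinAdj (adj G) u (splitAt n x) (splitAt n y)
  ; adj-sym = λ x y → joinAdj-sym G u (splitAt n x) (splitAt n y)
  ; adj-irr = λ x → joinAdj-irr G u (splitAt n x)
  }

module Submission where

-- H is a copy L(G) of G and a k-clique Q = {L u, R 0, …, R (k-2)} sharing only the
-- vertex L u, so a subgraph of H is coloured by gluing colourings of its two parts after
-- permuting colours to agree at u.  Hence χ(H) = χ(G), and (k-1)-colourable spanning
-- subgraphs of H are understood: by pigeonhole they miss a clique edge and, if χ(G) = k,
-- also an edge of G; conversely, missing a clique edge and an edge xy of G suffices as soon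
-- as χ(G - xy) = k - 1 (the clique minus an edge is coloured by collapsing its two ends).
-- Counting edges turns "misses two distinct edges" into "at least two edges removed", which
-- gives es_χ(H) = 2 and es_χ(H - e) = 1 in one direction, and criticality of G in the other.

open import Defs
open import Data.Nat using (ℕ; zero; suc; _+_; _∸_; _≤_; _<_; z≤n; s≤s; _≤?_)
open import Data.Nat.Properties
  using ( _<?_; ≤-refl; ≤-antisym; ≤-pred; <⇒≱; n≮n; ≰⇒>; <-cmp; <-asym
        ; +-mono-≤; +-suc; +-∸-assoc; n∸n≡0 )
open import Data.Fin
  using (Fin; zero; suc; toℕ; _≟_; fromℕ; inject₁; inject≤; punchOut; _↑ˡ_; _↑ʳ_; splitAt)
  renaming (join to joinFin)
open import Data.Fin.Properties
  using ( toℕ-injective; fromℕ≢inject₁; inject₁-injective; inject≤-injective; punchOut-injective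
        ; pigeonhole; splitAt-↑ˡ; splitAt-↑ʳ; join-splitAt; ↑ˡ-injective )
import Data.Fin.Properties as Fin
open import Data.Fin.Permutation.Components using (transpose; transpose-inverse)
open import Data.Bool using (true; false; _∧_; not; if_then_else_; T)
open import Data.Bool.Properties using (∨-comm; ∧-identityʳ; T-≡; T-∧; T-∨)
open import Data.Sum using (_⊎_; inj₁; inj₂; [_,_]′)
open import Data.Product using (∃; ∃₂; _×_; _,_; proj₁; proj₂)
open import Data.List using (map; allFin; tabulate)
open import Data.List.Properties using (map-tabulate; tabulate-cong)
open import Data.Nat.ListAction using (sum)
open import Function using (_∘_)
open import Function.Bundles using (_⇔_; mk⇔; Equivalence)
open import Relation.Nullary using (¬_; Dec; yes; no; contradiction)
open import Relation.Nullary.Decidable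
  using (⌊_⌋; isYes≗does; toWitness; fromWitness; dec-true; dec-false; decidable-stable)
open import Relation.Binary using (tri<; tri≈; tri>)
open import Relation.Binary.PropositionalEquality
  using (_≡_; _≢_; refl; sym; trans; cong; cong₂; subst; module ≡-Reasoning)

private variable
  n m t : ℕ
  X Y : Graph n
  a b c d x y : Fin n

⌊⌋-sound : ∀ {A : Set} (d : Dec A) → ⌊ d ⌋ ≡ true → A
⌊⌋-sound d h = toWitness {a? = d} (Equivalence.from T-≡ h)

⌊⌋-yes : ∀ {A : Set} (d : Dec A) → A → ⌊ d ⌋ ≡ true
⌊⌋-yes d a = trans (isYes≗does d) (dec-true d a)

⌊⌋-no : ∀ {A : Set} (d : Dec A) → ¬ A → ⌊ d ⌋ ≡ false
⌊⌋-no d ¬a = trans (isYes≗does d) (dec-false d ¬a)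

SamePair : Fin n → Fin n → Fin n → Fin n → Set
SamePair a b x y = (x ≡ a × y ≡ b) ⊎ (x ≡ b × y ≡ a)

samePair-sym : SamePair a b x y → SamePair x y a b
samePair-sym (inj₁ (refl , refl)) = inj₁ (refl , refl)
samePair-sym (inj₂ (refl , refl)) = inj₂ (refl , refl)

samePair⇒isPair : SamePair a b x y → isPair a b x y ≡ true
samePair⇒isPair {a = a} {b} {x} {y} s =
  Equivalence.to T-≡ (Equivalence.from (T-∨ {⌊ x ≟ a ⌋ ∧ ⌊ y ≟ b ⌋}) (both s))
  where
  both : SamePair a b x y → T (⌊ x ≟ a ⌋ ∧ ⌊ y ≟ b ⌋) ⊎ T (⌊ x ≟ b ⌋ ∧ ⌊ y ≟ a ⌋)
  both (inj₁ (p , q)) = inj₁ (Equivalence.from (T-∧ {⌊ x ≟ a ⌋}) (fromWitness p , fromWitness q))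
  both (inj₂ (p , q)) = inj₂ (Equivalence.from (T-∧ {⌊ x ≟ b ⌋}) (fromWitness p , fromWitness q))

isPair⇒samePair : isPair a b x y ≡ true → SamePair a b x y
isPair⇒samePair {a = a} {b} {x} {y} h
  with Equivalence.to (T-∨ {⌊ x ≟ a ⌋ ∧ ⌊ y ≟ b ⌋}) (Equivalence.from T-≡ h)
... | inj₁ t = let (p , q) = Equivalence.to (T-∧ {⌊ x ≟ a ⌋}) t in inj₁ (toWitness p , toWitness q)
... | inj₂ t = let (p , q) = Equivalence.to (T-∧ {⌊ x ≟ b ⌋}) t in inj₂ (toWitness p , toWitness q)

delete-adj⁻ : ∀ Y → adj (deleteEdge Y a b) x y ≡ true → adj Y x y ≡ true × ¬ SamePair a b x y
delete-adj⁻ {a = a} {b = b} {x = x} {y = y} Y h with adj Y x y | isPair a b x y in pair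
... | true | false = refl , λ s → contradiction (trans (sym (samePair⇒isPair s)) pair) λ ()

delete-adj⁺ : ∀ Y → adj Y x y ≡ true → ¬ SamePair a b x y → adj (deleteEdge Y a b) x y ≡ true
delete-adj⁺ {x = x} {y = y} {a = a} {b = b} Y h ¬s with isPair a b x y in pair
... | true  = contradiction (isPair⇒samePair pair) ¬s
... | false = trans (∧-identityʳ _) h

delete-misses : ∀ (Y : Graph n) → adj (deleteEdge Y a b) a b ≡ false
delete-misses {a = a} {b = b} Y with adj (deleteEdge Y a b) a b in h
... | false = refl
... | true  = contradiction (inj₁ (refl , refl)) (proj₂ (delete-adj⁻ Y h))

adjacent-distinct : adj Y a b ≡ true → a ≢ b
adjacent-distinct {Y = Y} h refl = contradiction (trans (sym h) (adj-irr Y _)) λ ()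

EdgeMap : Graph n → Graph m → (Fin n → Fin m) → Set
EdgeMap X Y f = ∀ x y → adj X x y ≡ true → adj Y (f x) (f y) ≡ true

delete-sub : ∀ (Y : Graph n) → SpanningSub (deleteEdge Y a b) Y
delete-sub Y x y h = proj₁ (delete-adj⁻ Y h)

delete₂-sub : ∀ (Y : Graph n) → SpanningSub (deleteEdge (deleteEdge Y a b) c d) Y
delete₂-sub {a = a} {b = b} Y x y h = delete-sub Y x y (delete-sub (deleteEdge Y a b) x y h)

delete₂-misses : ∀ (Y : Graph n) → adj (deleteEdge (deleteEdge Y a b) c d) a b ≡ false
delete₂-misses {a = a} {b = b} {c = c} {d = d} Y
  with adj (deleteEdge (deleteEdge Y a b) c d) a b in h
... | false = refl
... | true  = trans (sym (delete-sub (deleteEdge Y a b) a b h)) (delete-misses Y)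

sub-delete : SpanningSub X Y → adj X a b ≡ false → SpanningSub X (deleteEdge Y a b)
sub-delete {X = X} {Y = Y} X⊆Y miss x y h = delete-adj⁺ Y (X⊆Y x y h) λ where
  (inj₁ (refl , refl)) → contradiction (trans (sym h) miss) λ ()
  (inj₂ (refl , refl)) → contradiction (trans (sym h) (trans (adj-sym X _ _) miss)) λ ()

edgeMap-delete : ∀ {X : Graph n} {Y : Graph m} {f} → (∀ {x y} → f x ≡ f y → x ≡ y) →
  EdgeMap X Y f → EdgeMap (deleteEdge X a b) (deleteEdge Y (f a) (f b)) f
edgeMap-delete {X = X} {Y = Y} f-inj hom x y h with delete-adj⁻ X h
... | e , ¬same = delete-adj⁺ Y (hom x y e) λ where
  (inj₁ (p , q)) → ¬same (inj₁ (f-inj p , f-inj q))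
  (inj₂ (p , q)) → ¬same (inj₂ (f-inj p , f-inj q))

edgeMap-avoid : ∀ {X : Graph n} {Y : Graph m} {f} {a b : Fin m} →
  (∀ x y → ¬ SamePair a b (f x) (f y)) → EdgeMap X Y f → EdgeMap X (deleteEdge Y a b) f
edgeMap-avoid {Y = Y} avoid hom x y h = delete-adj⁺ Y (hom x y h) (avoid x y)

sumFin : (n : ℕ) → (Fin n → ℕ) → ℕ
sumFin n f = sum (tabulate f)

sumFin-mono : ∀ n {f g : Fin n → ℕ} → (∀ i → f i ≤ g i) → sumFin n f ≤ sumFin n g
sumFin-mono zero    f≤g = z≤n
sumFin-mono (suc n) f≤g = +-mono-≤ (f≤g zero) (sumFin-mono n (f≤g ∘ suc))

sumFin-bump : ∀ n {f g : Fin n → ℕ} (p : Fin n) → (∀ i → i ≢ p → f i ≡ g i) →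
  f p ≡ suc (g p) → sumFin n f ≡ suc (sumFin n g)
sumFin-bump (suc n) zero same bump =
  cong₂ _+_ bump (cong sum (tabulate-cong λ i → same (suc i) λ ()))
sumFin-bump (suc n) {f} {g} (suc p) same bump =
  trans (cong₂ _+_ (same zero λ ()) (sumFin-bump n p same-tail bump)) (+-suc (g zero) _)
  where
  same-tail : ∀ i → i ≢ p → f (suc i) ≡ g (suc i)
  same-tail i i≢p = same (suc i) (i≢p ∘ Fin.suc-injective)

edgeIndicator : Graph n → Fin n → Fin n → ℕ
edgeIndicator Y i j = if ⌊ toℕ i <? toℕ j ⌋ ∧ adj Y i j then 1 else 0

edgeCount≡sumFin : ∀ {n} (Y : Graph n) → edgeCount Y ≡ sumFin n (λ i → sumFin n (edgeIndicator Y i))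
edgeCount≡sumFin {n} Y =
  trans (sum-allFin _) (cong sum (tabulate-cong (λ i → sum-allFin (edgeIndicator Y i))))
  where
  sum-allFin : (f : Fin n → ℕ) → sum (map f (allFin n)) ≡ sumFin n f
  sum-allFin f = cong sum (map-tabulate (λ i → i) f)

edgeCount-cong : (∀ x y → adj X x y ≡ adj Y x y) → edgeCount X ≡ edgeCount Y
edgeCount-cong {X = X} {Y = Y} same = begin
  edgeCount X                                   ≡⟨ edgeCount≡sumFin X ⟩
  sumFin _ (λ i → sumFin _ (edgeIndicator X i)) ≡⟨ cong sum (tabulate-cong λ i →
                                                     cong sum (tabulate-cong λ j → indicator-cong i j)) ⟩
  sumFin _ (λ i → sumFin _ (edgeIndicator Y i)) ≡⟨ edgeCount≡sumFin Y ⟨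
  edgeCount Y                                   ∎
  where
  open ≡-Reasoning
  indicator-cong : ∀ i j → edgeIndicator X i j ≡ edgeIndicator Y i j
  indicator-cong i j = cong (λ e → if ⌊ toℕ i <? toℕ j ⌋ ∧ e then 1 else 0) (same i j)

edgeCount-mono : SpanningSub X Y → edgeCount X ≤ edgeCount Y
edgeCount-mono {X = X} {Y = Y} X⊆Y
  rewrite edgeCount≡sumFin X | edgeCount≡sumFin Y =
  sumFin-mono _ λ i → sumFin-mono _ λ j → indicator-mono i j
  where
  indicator-mono : ∀ i j → edgeIndicator X i j ≤ edgeIndicator Y i j
  indicator-mono i j with ⌊ toℕ i <? toℕ j ⌋ | adj X i j in h
  ... | false | _     = z≤n
  ... | true  | false = z≤n
  ... | true  | true  rewrite X⊆Y i j h = ≤-refl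

-- Deleting the edge {a,b} with a < b only changes the indicator at (a,b).
edgeCount-delete< : toℕ a < toℕ b → adj Y a b ≡ true →
  edgeCount Y ≡ suc (edgeCount (deleteEdge Y a b))
edgeCount-delete< {a = a} {b = b} {Y = Y} a<b ab
  rewrite edgeCount≡sumFin Y | edgeCount≡sumFin (deleteEdge Y a b) =
  sumFin-bump _ a (λ i i≢a → cong sum (tabulate-cong λ j → unchanged i j (λ (i≡a , _) → i≢a i≡a)))
    (sumFin-bump _ b (λ j j≢b → unchanged a j (λ (_ , j≡b) → j≢b j≡b)) at-ab)
  where
  unchanged : ∀ i j → ¬ (i ≡ a × j ≡ b) → edgeIndicator Y i j ≡ edgeIndicator (deleteEdge Y a b) i j
  unchanged i j ¬ab with isPair a b i j in pair
  ... | false rewrite ∧-identityʳ (adj Y i j) = refl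
  ... | true with isPair⇒samePair pair
  ...   | inj₁ i,j≡a,b = contradiction i,j≡a,b ¬ab
  ...   | inj₂ (refl , refl) rewrite ⌊⌋-no (toℕ b <? toℕ a) (<-asym a<b) = refl
  at-ab : edgeIndicator Y a b ≡ suc (edgeIndicator (deleteEdge Y a b) a b)
  at-ab rewrite ⌊⌋-yes (toℕ a <? toℕ b) a<b | ab
              | samePair⇒isPair {a = a} {b} {a} {b} (inj₁ (refl , refl)) = refl

edgeCount-delete : adj Y a b ≡ true → edgeCount Y ≡ suc (edgeCount (deleteEdge Y a b))
edgeCount-delete {Y = Y} {a = a} {b = b} ab with <-cmp (toℕ a) (toℕ b)
... | tri< a<b _ _ = edgeCount-delete< {Y = Y} a<b ab
... | tri≈ _ a≡b _ = contradiction (toℕ-injective a≡b) (adjacent-distinct {Y = Y} ab)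
... | tri> _ _ b<a =
  trans (edgeCount-delete< {Y = Y} b<a (trans (adj-sym Y b a) ab))
        (cong suc (edgeCount-cong {X = deleteEdge Y b a} {Y = deleteEdge Y a b} swap))
  where
  swap : ∀ x y → adj (deleteEdge Y b a) x y ≡ adj (deleteEdge Y a b) x y
  swap x y = cong (λ e → adj Y x y ∧ not e) (∨-comm (⌊ x ≟ b ⌋ ∧ ⌊ y ≟ a ⌋) (⌊ x ≟ a ⌋ ∧ ⌊ y ≟ b ⌋))

removed-delete : adj Y a b ≡ true → SpanningSub X (deleteEdge Y a b) →
  removed Y X ≡ suc (removed (deleteEdge Y a b) X)
removed-delete {Y = Y} {a = a} {b = b} {X = X} ab X⊆Y-ab = begin
  edgeCount Y ∸ edgeCount X                        ≡⟨ cong (_∸ edgeCount X) (edgeCount-delete {Y = Y} ab) ⟩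
  suc (edgeCount (deleteEdge Y a b)) ∸ edgeCount X ≡⟨ +-∸-assoc 1 X≤Y-ab ⟩
  suc (removed (deleteEdge Y a b) X)               ∎
  where
  open ≡-Reasoning
  X≤Y-ab : edgeCount X ≤ edgeCount (deleteEdge Y a b)
  X≤Y-ab = edgeCount-mono {X = X} {Y = deleteEdge Y a b} X⊆Y-ab

removed-self : ∀ (Y : Graph n) → removed Y Y ≡ 0
removed-self Y = n∸n≡0 (edgeCount Y)

removed-one : adj Y a b ≡ true → removed Y (deleteEdge Y a b) ≡ 1
removed-one {Y = Y} {a = a} {b = b} ab =
  trans (removed-delete {Y = Y} {X = deleteEdge Y a b} ab (λ _ _ h → h))
        (cong suc (removed-self (deleteEdge Y a b)))

removed-two : adj Y a b ≡ true → adj (deleteEdge Y a b) c d ≡ true →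
  removed Y (deleteEdge (deleteEdge Y a b) c d) ≡ 2
removed-two {Y = Y} {a = a} {b = b} {c = c} {d = d} ab cd =
  trans (removed-delete {Y = Y} {X = deleteEdge (deleteEdge Y a b) c d} ab
          (delete-sub (deleteEdge Y a b)))
        (cong suc (removed-one {Y = deleteEdge Y a b} cd))

removed-pos : SpanningSub X Y → adj Y a b ≡ true → adj X a b ≡ false → 1 ≤ removed Y X
removed-pos {X = X} {Y = Y} X⊆Y ab miss
  rewrite removed-delete {Y = Y} {X = X} ab (sub-delete {X = X} {Y = Y} X⊆Y miss) = s≤s z≤n

removed-two-lb : SpanningSub X Y → adj Y a b ≡ true → adj X a b ≡ false →
  adj (deleteEdge Y a b) c d ≡ true → adj X c d ≡ false → 2 ≤ removed Y X
removed-two-lb {X = X} {Y = Y} X⊆Y ab miss-ab cd miss-cd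
  rewrite removed-delete {Y = Y} {X = X} ab (sub-delete {X = X} {Y = Y} X⊆Y miss-ab) =
  s≤s (removed-pos {X = X} {Y = deleteEdge Y _ _} (sub-delete {X = X} {Y = Y} X⊆Y miss-ab)
         cd miss-cd)

Proper : Graph n → (Fin n → Fin m) → Set
Proper X col = ∀ x y → adj X x y ≡ true → col x ≢ col y

proper-misses : ∀ (X : Graph n) {col : Fin n → Fin m} → Proper X col → col a ≡ col b → adj X a b ≡ false
proper-misses {a = a} {b = b} X proper same with adj X a b in ab
... | false = refl
... | true  = contradiction same (proper a b ab)

chromNum-unique : ChromNum X m → ChromNum X t → m ≡ t
chromNum-unique (col₁ , least₁) (col₂ , least₂) = ≤-antisym (least₁ _ col₂) (least₂ _ col₁)

colour-pullback : ∀ {X : Graph n} {Y : Graph t} {f} → EdgeMap X Y f → Colorable Y m → Colorable X m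
colour-pullback hom (col , proper) = col ∘ _ , λ x y xy → proper _ _ (hom x y xy)

colour-weaken : m ≤ t → Colorable X m → Colorable X t
colour-weaken m≤t (col , proper) =
  (λ x → inject≤ (col x) m≤t) , λ x y xy same → proper x y xy (inject≤-injective m≤t m≤t _ _ same)

-- Putting the edge {a,b} back costs at most one colour: a gets a fresh colour.
colour-undelete : ∀ (Y : Graph n) → Colorable (deleteEdge Y a b) m → Colorable Y (suc m)
colour-undelete {a = a} {b = b} {m = m} Y (col , proper) = col′ , proper′
  where
  col′ : Fin _ → Fin (suc m)
  col′ x with x ≟ a
  ... | yes _ = fromℕ m
  ... | no  _ = inject₁ (col x)
  proper′ : Proper Y col′
  proper′ x y xy with x ≟ a | y ≟ a
  ... | yes refl | yes refl = contradiction refl (adjacent-distinct {Y = Y} xy)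
  ... | yes _    | no  _    = fromℕ≢inject₁
  ... | no  _    | yes _    = fromℕ≢inject₁ ∘ sym
  ... | no  x≢a  | no  y≢a  = proper x y (delete-adj⁺ Y xy not-ab) ∘ inject₁-injective
    where
    not-ab : ¬ SamePair a b x y
    not-ab (inj₁ (x≡a , _)) = x≢a x≡a
    not-ab (inj₂ (_ , y≡a)) = y≢a y≡a

chromNum-not-colourable : ChromNum X (suc m) → ¬ Colorable X m
chromNum-not-colourable {m = m} (_ , least) col = n≮n m (least m col)

-- … and, colourability being monotone in the number of colours, conversely.
chromNum-intro : Colorable X (suc m) → ¬ Colorable X m → ChromNum X (suc m)
chromNum-intro {X = X} {m = m} col ¬col = col , λ t col′ →
  decidable-stable (suc m ≤? t) λ m+1≰t → ¬col (colour-weaken {X = X} (≤-pred (≰⇒> m+1≰t)) col′)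

-- χ(Y - ab) ≥ χ(Y) - 1, so a (k-1)-colouring of Y - ab shows χ(Y - ab) = k - 1.
chromNum-delete : ∀ (Y : Graph n) → ChromNum Y (suc m) → Colorable (deleteEdge Y a b) m →
  ChromNum (deleteEdge Y a b) m
chromNum-delete Y (_ , least) col = col , λ t col′ → ≤-pred (least (suc t) (colour-undelete Y col′))

-- Pigeonhole: if X is coloured with fewer than t colours, two of the vertices f(0),…,f(t-1)
-- share a colour and hence are not adjacent.
clique-gap : ∀ {X : Graph n} (f : Fin t → Fin n) → m < t → Colorable X m →
  ∃₂ λ p q → p ≢ q × adj X (f p) (f q) ≡ false
clique-gap {X = X} f m<t (col , proper) with pigeonhole m<t (col ∘ f)
... | p , q , p<q , same = p , q , Fin.<⇒≢ p<q , proper-misses X proper same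

clique-bound : ∀ {X : Graph n} (f : Fin t → Fin n) → (∀ p q → p ≢ q → adj X (f p) (f q) ≡ true) →
  Colorable X m → t ≤ m
clique-bound {t = t} {m = m} {X = X} f clique col = decidable-stable (t ≤? m) λ t≰m →
  let (p , q , p≢q , miss) = clique-gap {X = X} f (≰⇒> t≰m) col
  in contradiction (trans (sym (clique p q p≢q)) miss) λ ()

-- If χ(Y) = m + 1 and deleting one edge already lowers it, then es_χ(Y) = 1: any
-- m-colourable spanning subgraph X differs from Y, because Y itself is not m-colourable.
esChi-one : ∀ (Y : Graph n) → ChromNum Y (suc m) → adj Y a b ≡ true →
  Colorable (deleteEdge Y a b) m → EsChi Y 1
esChi-one {m = m} {a = a} {b = b} Y χY ab col =
  suc m , χY ,
  (deleteEdge Y a b , delete-sub Y , chromNum-delete Y χY col , removed-one {Y = Y} ab) ,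
  minimal
  where
  minimal : ∀ X → SpanningSub X Y → ChromNum X m → 1 ≤ removed Y X
  minimal X X⊆Y ((κ , proper) , _) = decidable-stable (1 ≤? removed Y X) λ none-removed →
    chromNum-not-colourable {X = Y} χY
      (κ , λ x y xy same →
        none-removed (removed-pos {X = X} {Y = Y} X⊆Y xy (proper-misses X proper same)))

transpose-hit : ∀ (i j : Fin n) → transpose i j i ≡ j
transpose-hit i j rewrite dec-true (i ≟ i) refl = refl

transpose-injective : ∀ (i j : Fin n) {a b} → transpose i j a ≡ transpose i j b → a ≡ b
transpose-injective i j {a} {b} eq = begin
  a                              ≡⟨ transpose-inverse j i ⟨
  transpose j i (transpose i j a) ≡⟨ cong (transpose j i) eq ⟩
  transpose j i (transpose i j b) ≡⟨ transpose-inverse j i ⟩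
  b                              ∎
  where open ≡-Reasoning

-- An m-colouring of K_{m+1} minus the edge pq: q receives the colour of p and the
-- other vertices keep distinct colours.
collapse : (p q : Fin (suc m)) → p ≢ q → Fin (suc m) → Fin m
collapse p q p≢q x with x ≟ q
... | yes _   = punchOut (p≢q ∘ sym)
... | no  x≢q = punchOut (x≢q ∘ sym)

collapse-fibres : ∀ (p q : Fin (suc m)) (p≢q : p ≢ q) {x y} →
  collapse p q p≢q x ≡ collapse p q p≢q y → x ≡ y ⊎ SamePair p q x y
collapse-fibres p q p≢q {x} {y} same with x ≟ q | y ≟ q
... | yes refl | yes refl = inj₁ refl
... | yes refl | no  y≢q  = inj₂ (inj₂ (refl , sym (punchOut-injective (p≢q ∘ sym) (y≢q ∘ sym) same)))
... | no  x≢q  | yes refl = inj₂ (inj₁ (punchOut-injective (x≢q ∘ sym) (p≢q ∘ sym) same , refl))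
... | no  x≢q  | no  y≢q  = inj₁ (punchOut-injective (x≢q ∘ sym) (y≢q ∘ sym) same)

-- The graph H = G_u ⋈ K_k on Fin (n + K), where k = K + 1 = J + 2 (the argument only needs
-- k ≥ 2): L embeds G, the R i are the new vertices, and Q lists the clique L u, R 0, …, R (K-1).
module JoinGraph {n} (G : Graph n) (u : Fin n) (J : ℕ) where

  K k : ℕ
  K = suc J
  k = suc K

  H : Graph (n + K)
  H = join G u k

  L : Fin n → Fin (n + K)
  L x = x ↑ˡ K

  R : Fin K → Fin (n + K)
  R i = n ↑ʳ i

  Q : Fin k → Fin (n + K)
  Q zero    = L u
  Q (suc i) = R i

  H∖G : Fin n → Fin n → Graph (n + K)
  H∖G x y = deleteEdge H (L x) (L y)

  H∖Q : Fin k → Fin k → Graph (n + K)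
  H∖Q p q = deleteEdge H (Q p) (Q q)

  vertexView : ∀ v → (∃ λ x → v ≡ L x) ⊎ (∃ λ i → v ≡ R i)
  vertexView v with splitAt n v in split
  ... | inj₁ x = inj₁ (x , trans (sym (join-splitAt n K v)) (cong (joinFin n K) split))
  ... | inj₂ i = inj₂ (i , trans (sym (join-splitAt n K v)) (cong (joinFin n K) split))

  L-injective : ∀ {x y} → L x ≡ L y → x ≡ y
  L-injective = ↑ˡ-injective K _ _

  L≢R : ∀ x i → L x ≢ R i
  L≢R x i eq with trans (sym (splitAt-↑ˡ n x K)) (trans (cong (splitAt n) eq) (splitAt-↑ʳ n K i))
  ... | ()

  Q≡L : ∀ p {x} → Q p ≡ L x → p ≡ zero
  Q≡L zero    _  = refl
  Q≡L (suc i) eq = contradiction (sym eq) (L≢R _ i)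

  adj-LL : ∀ x y → adj H (L x) (L y) ≡ adj G x y
  adj-LL x y rewrite splitAt-↑ˡ n x K | splitAt-↑ˡ n y K = refl

  adj-LR : ∀ x i → adj H (L x) (R i) ≡ ⌊ x ≟ u ⌋
  adj-LR x i rewrite splitAt-↑ˡ n x K | splitAt-↑ʳ n K i = refl

  adj-RR : ∀ i j → adj H (R i) (R j) ≡ not ⌊ i ≟ j ⌋
  adj-RR i j rewrite splitAt-↑ʳ n K i | splitAt-↑ʳ n K j = refl

  L-edgeMap : EdgeMap G H L
  L-edgeMap x y xy = trans (adj-LL x y) xy

  CliqueIn : Graph (n + K) → Set
  CliqueIn Y = ∀ p q → p ≢ q → adj Y (Q p) (Q q) ≡ true

  clique-H : CliqueIn H
  clique-H zero    zero    p≢q = contradiction refl p≢q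
  clique-H zero    (suc j) _   = trans (adj-LR u j) (⌊⌋-yes (u ≟ u) refl)
  clique-H (suc i) zero    _   = trans (adj-sym H (R i) (L u)) (clique-H zero (suc i) λ ())
  clique-H (suc i) (suc j) p≢q = trans (adj-RR i j) (cong not (⌊⌋-no (i ≟ j) (p≢q ∘ cong suc)))

  edgeView : ∀ {a b} → adj H a b ≡ true →
    (∃₂ λ x y → a ≡ L x × b ≡ L y × adj G x y ≡ true) ⊎ (∃₂ λ p q → a ≡ Q p × b ≡ Q q)
  edgeView {a} {b} ab with vertexView a | vertexView b
  ... | inj₁ (x , refl) | inj₁ (y , refl) = inj₁ (x , y , refl , refl , trans (sym (adj-LL x y)) ab)
  ... | inj₂ (i , refl) | inj₂ (j , refl) = inj₂ (suc i , suc j , refl , refl)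
  ... | inj₁ (x , refl) | inj₂ (i , refl) with ⌊⌋-sound (x ≟ u) (trans (sym (adj-LR x i)) ab)
  ...   | refl = inj₂ (zero , suc i , refl , refl)
  edgeView ab | inj₂ (i , refl) | inj₁ (x , refl)
    with ⌊⌋-sound (x ≟ u) (trans (sym (adj-LR x i)) (trans (adj-sym H (L x) (R i)) ab))
  ...   | refl = inj₂ (suc i , zero , refl , refl)

  G-edge≢clique-edge : ∀ {x y p q} → p ≢ q → ¬ SamePair (L x) (L y) (Q p) (Q q)
  G-edge≢clique-edge {p = p} {q} p≢q (inj₁ (Qp≡Lx , Qq≡Ly)) =
    p≢q (trans (Q≡L p Qp≡Lx) (sym (Q≡L q Qq≡Ly)))
  G-edge≢clique-edge {p = p} {q} p≢q (inj₂ (Qp≡Ly , Qq≡Lx)) =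
    p≢q (trans (Q≡L p Qp≡Ly) (sym (Q≡L q Qq≡Lx)))

  clique-H∖G : ∀ {x y} → CliqueIn (H∖G x y)
  clique-H∖G p q p≢q = delete-adj⁺ H (clique-H p q p≢q) (G-edge≢clique-edge p≢q)

  L-edgeMap-H∖Q : ∀ {p q} → p ≢ q → EdgeMap G (H∖Q p q) L
  L-edgeMap-H∖Q p≢q =
    edgeMap-avoid {X = G} {Y = H} (λ x y → G-edge≢clique-edge p≢q ∘ samePair-sym) L-edgeMap

  L-edgeMap-H∖G : ∀ {x y} → EdgeMap (deleteEdge G x y) (H∖G x y) L
  L-edgeMap-H∖G = edgeMap-delete {X = G} {Y = H} L-injective L-edgeMap

  -- Gluing: X ⊆ H is m-colourable once its copy of G and its clique are, since the two parts
  -- share only u; the clique colours are permuted by a transposition to agree at u.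
  glue : ∀ {X : Graph (n + K)} {m} → SpanningSub X H →
    (cG : Fin n → Fin m) → (∀ x y → adj X (L x) (L y) ≡ true → cG x ≢ cG y) →
    (cQ : Fin k → Fin m) → (∀ p q → adj X (Q p) (Q q) ≡ true → cQ p ≢ cQ q) →
    Colorable X m
  glue {X} {m} X⊆H cG G-proper cQ Q-proper = col , proper
    where
    σ : Fin m → Fin m
    σ = transpose (cQ zero) (cG u)
    col : Fin (n + K) → Fin m
    col v = [ cG , (λ i → σ (cQ (suc i))) ]′ (splitAt n v)
    col-L : ∀ x → col (L x) ≡ cG x
    col-L x rewrite splitAt-↑ˡ n x K = refl
    col-Q : ∀ p → col (Q p) ≡ σ (cQ p)
    col-Q zero    = trans (col-L u) (sym (transpose-hit (cQ zero) (cG u)))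
    col-Q (suc i) rewrite splitAt-↑ʳ n K i = refl
    proper : Proper X col
    proper v w vw with edgeView (X⊆H v w vw)
    ... | inj₁ (x , y , refl , refl , _) = λ same →
      G-proper x y vw (trans (sym (col-L x)) (trans same (col-L y)))
    ... | inj₂ (p , q , refl , refl) = λ same →
      Q-proper p q vw (transpose-injective (cQ zero) (cG u) (trans (sym (col-Q p)) (trans same (col-Q q))))

  colour-H : Colorable G k → Colorable H k
  colour-H (cG , G-proper) =
    glue {X = H} (λ _ _ e → e) cG (λ x y e → G-proper x y (trans (sym (adj-LL x y)) e))
      (λ p → p) (λ p q e p≡q → adjacent-distinct {Y = H} e (cong Q p≡q))

  -- X ⊆ H missing a clique edge pq is K-colourable if its copy of G lies in a K-colourable
  -- graph G′: the clique is coloured by collapsing q onto p.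
  colour-missing-clique-edge : ∀ {p q} (X : Graph (n + K)) (G′ : Graph n) → SpanningSub X H →
    (p≢q : p ≢ q) → adj X (Q p) (Q q) ≡ false →
    (∀ x y → adj X (L x) (L y) ≡ true → adj G′ x y ≡ true) → Colorable G′ K → Colorable X K
  colour-missing-clique-edge {p} {q} X G′ X⊆H p≢q miss G-in-G′ (cG , G-proper) =
    glue {X = X} X⊆H cG (λ x y e → G-proper x y (G-in-G′ x y e)) (collapse p q p≢q) Q-proper
    where
    Q-proper : ∀ a b → adj X (Q a) (Q b) ≡ true → collapse p q p≢q a ≢ collapse p q p≢q b
    Q-proper a b ab same with collapse-fibres p q p≢q {a} {b} same
    ... | inj₁ refl                 = adjacent-distinct {Y = X} ab refl
    ... | inj₂ (inj₁ (refl , refl)) = contradiction (trans (sym ab) miss) λ ()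
    ... | inj₂ (inj₂ (refl , refl)) = contradiction (trans (sym ab) (trans (adj-sym X _ _) miss)) λ ()

  L-edges-avoiding : ∀ {X : Graph (n + K)} {x y} → SpanningSub X H → adj X (L x) (L y) ≡ false →
    ∀ a b → adj X (L a) (L b) ≡ true → adj (deleteEdge G x y) a b ≡ true
  L-edges-avoiding {X} X⊆H miss a b ab
    with delete-adj⁻ H (sub-delete {X = X} {Y = H} X⊆H miss (L a) (L b) ab)
  ... | e , ¬same = delete-adj⁺ G (trans (sym (adj-LL a b)) e) λ where
    (inj₁ (refl , refl)) → ¬same (inj₁ (refl , refl))
    (inj₂ (refl , refl)) → ¬same (inj₂ (refl , refl))

  colour-H∖G∖Q : ∀ {x y p q} → p ≢ q → Colorable (deleteEdge G x y) K →
    Colorable (deleteEdge (H∖G x y) (Q p) (Q q)) K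
  colour-H∖G∖Q {x} {y} {p} {q} p≢q =
    colour-missing-clique-edge D (deleteEdge G x y) (delete₂-sub H) p≢q (delete-misses (H∖G x y))
      (L-edges-avoiding {X = D} (delete₂-sub H) (delete₂-misses H))
    where
    D : Graph (n + K)
    D = deleteEdge (H∖G x y) (Q p) (Q q)

  colour-H∖Q∖G : ∀ {x y p q} → p ≢ q → Colorable (deleteEdge G x y) K →
    Colorable (deleteEdge (H∖Q p q) (L x) (L y)) K
  colour-H∖Q∖G {x} {y} {p} {q} p≢q =
    colour-missing-clique-edge D (deleteEdge G x y) (delete₂-sub H) p≢q (delete₂-misses H)
      (L-edges-avoiding {X = D} (delete₂-sub H) (delete-misses (H∖Q p q)))
    where
    D : Graph (n + K)
    D = deleteEdge (H∖Q p q) (L x) (L y)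

  -- χ(H) = χ(G) = k: G embeds in H, and a k-colouring of G extends.
  chromNum-H : ChromNum G k → ChromNum H k
  chromNum-H (colG , least) =
    colour-H colG , λ m col → least m (colour-pullback {X = G} {Y = H} L-edgeMap col)

  -- Deleting an edge of G from H keeps χ = k, as the clique remains …
  chromNum-H∖G : ∀ {x y} → Colorable H k → ChromNum (H∖G x y) k
  chromNum-H∖G {x} {y} colH =
    colour-pullback {X = H∖G x y} {Y = H} (delete-sub H) colH ,
    λ m col → clique-bound {X = H∖G x y} Q clique-H∖G col

  -- … and so does deleting a clique edge, as G remains.
  chromNum-H∖Q : ∀ {p q} → ChromNum G k → p ≢ q → ChromNum (H∖Q p q) k
  chromNum-H∖Q {p} {q} χG p≢q =
    colour-pullback {X = H∖Q p q} {Y = H} (delete-sub H) (colour-H (proj₁ χG)) ,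
    λ m col → proj₂ χG m (colour-pullback {X = G} {Y = H∖Q p q} (L-edgeMap-H∖Q p≢q) col)

  -- Let X ⊆ Y, with the clique in Y, be K-colourable. By pigeonhole X misses a clique edge,
  -- and an edge LxLy of Y with equally coloured ends would be a second missing edge. So if
  -- fewer than two edges were removed, the colouring of X restricts to any G′ mapped into Y.
  colour-restriction : ∀ {Y X : Graph (n + K)} {G′ : Graph n} → SpanningSub X Y → CliqueIn Y →
    EdgeMap G′ Y L → removed Y X < 2 → Colorable X K → Colorable G′ K
  colour-restriction {Y} {X} X⊆Y clique hom few (col , proper) = col ∘ L , λ x y xy same →
    let (p , q , p≢q , miss-pq) = clique-gap {X = X} Q ≤-refl (col , proper)
    in <⇒≱ few (removed-two-lb {X = X} {Y = Y} X⊆Y (hom x y xy) (proper-misses X proper same)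
                  (delete-adj⁺ Y (clique p q p≢q) (G-edge≢clique-edge p≢q)) miss-pq)

  Q₀≢Q₁ : _≢_ {A = Fin k} zero (suc zero)
  Q₀≢Q₁ ()

  module FromCriticalG (χG : ChromNum G k)
                       (critical : ∀ a b → adj G a b ≡ true → ChromNum (deleteEdge G a b) K)
                       {v} (uv : adj G u v ≡ true) where

    χH : ChromNum H k
    χH = chromNum-H χG

    -- es_χ(H) = 2: deleting uv and Q₀Q₁ suffices, and every K-colourable X ⊆ H misses
    -- a clique edge and an edge of G.
    esChi-H : EsChi H 2
    esChi-H = k , χH , (H₂ , delete₂-sub H , χH₂ , removed-two {Y = H} (L-edgeMap u v uv) Q₀Q₁) ,
              minimal
      where
      H₂ : Graph (n + K)
      H₂ = deleteEdge (H∖G u v) (Q zero) (Q (suc zero))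

      Q₀Q₁ : adj (H∖G u v) (Q zero) (Q (suc zero)) ≡ true
      Q₀Q₁ = clique-H∖G zero (suc zero) Q₀≢Q₁

      χH₂ : ChromNum H₂ K
      χH₂ = chromNum-delete (H∖G u v) (chromNum-H∖G (proj₁ χH))
              (colour-H∖G∖Q Q₀≢Q₁ (proj₁ (critical u v uv)))

      minimal : ∀ X → SpanningSub X H → ChromNum X K → 2 ≤ removed H X
      minimal X X⊆H (colX , _) = decidable-stable (2 ≤? removed H X) λ few →
        chromNum-not-colourable {X = G} χG
          (colour-restriction {Y = H} {X = X} {G′ = G} X⊆H clique-H L-edgeMap (≰⇒> few) colX)

    -- es_χ(H - e) = 1 for every edge e: delete Q₀Q₁ as well if e lies in G, and uv otherwise.
    esChi-H∖edge : ∀ a b → adj H a b ≡ true → EsChi (deleteEdge H a b) 1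
    esChi-H∖edge a b ab with edgeView ab
    ... | inj₁ (x , y , refl , refl , xy) =
      esChi-one (H∖G x y) (chromNum-H∖G (proj₁ χH)) (clique-H∖G zero (suc zero) Q₀≢Q₁)
        (colour-H∖G∖Q Q₀≢Q₁ (proj₁ (critical x y xy)))
    ... | inj₂ (p , q , refl , refl) =
      esChi-one (H∖Q p q) (chromNum-H∖Q χG p≢q) (L-edgeMap-H∖Q p≢q u v uv)
        (colour-H∖Q∖G p≢q (proj₁ (critical u v uv)))
      where
      p≢q : p ≢ q
      p≢q p≡q = adjacent-distinct {Y = H} ab (cong Q p≡q)

  forward : InFchi k G → (∃ λ v → adj G u v ≡ true) → InFk2 k H
  forward (χG , critical) (v , uv) =
    χH , esChi-H , λ a b ab → 1 , esChi-H∖edge a b ab , s≤s (s≤s z≤n)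
    where open FromCriticalG χG critical uv

  -- If χ(H) = k and es_χ(H) = 2 then χ(G) = k: a K-colouring of G would make H - Q₀Q₁
  -- K-colourable, giving es_χ(H) = 1.
  chromNum-G : ChromNum H k → EsChi H 2 → ChromNum G k
  chromNum-G χH (k′ , χH′ , _ , minimal) =
    chromNum-intro {X = G} (colour-pullback {X = G} {Y = H} L-edgeMap (proj₁ χH)) not-K-colourable
    where
    not-K-colourable : ¬ Colorable G K
    not-K-colourable colG with chromNum-unique {X = H} χH′ χH
    ... | refl = contradiction (subst (2 ≤_) (removed-one {Y = H} (clique-H zero (suc zero) Q₀≢Q₁))
                                  (minimal (H∖Q zero (suc zero)) (delete-sub H) χH∖Q₀Q₁))
                   λ { (s≤s ()) }
      where
      χH∖Q₀Q₁ : ChromNum (H∖Q zero (suc zero)) K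
      χH∖Q₀Q₁ = chromNum-delete H χH
        (colour-missing-clique-edge (H∖Q zero (suc zero)) G (delete-sub H) Q₀≢Q₁ (delete-misses H)
          (λ x y e → trans (sym (adj-LL x y)) (delete-sub H (L x) (L y) e)) colG)

  -- If moreover es_χ(H - e) < 2 for every edge e, then G is critical: for an edge ab of G,
  -- the witness Z of es_χ(H - ab) < 2 restricts to a K-colouring of G - ab.
  G-critical : ChromNum H k → ChromNum G k →
    (∀ a b → adj H a b ≡ true → ∃ λ s → EsChi (deleteEdge H a b) s × s < 2) →
    ∀ a b → adj G a b ≡ true → ChromNum (deleteEdge G a b) K
  G-critical χH χG esChi-H∖edge a b ab with esChi-H∖edge (L a) (L b) (L-edgeMap a b ab)
  ... | s , (_ , χD , (Z , Z⊆D , χZ , removed≡s) , _) , s<2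
    with chromNum-unique {X = H∖G a b} χD (chromNum-H∖G (proj₁ χH))
  ...   | refl = chromNum-delete G χG
                   (colour-restriction {Y = H∖G a b} {X = Z} {G′ = deleteEdge G a b} Z⊆D
                     clique-H∖G L-edgeMap-H∖G (subst (_< 2) (sym removed≡s) s<2) (proj₁ χZ))

  backward : InFk2 k H → InFchi k G
  backward (χH , esChi-H , esChi-H∖edge) = χG , G-critical χH χG esChi-H∖edge
    where
    χG : ChromNum G k
    χG = chromNum-G χH esChi-H

theorem3p1 : ∀ {n} (G : Graph n) (u : Fin n) (k : ℕ) → 3 ≤ k → NoIsolated G →
    (InFchi k G ⇔ InFk2 k (join G u k))
theorem3p1 G u (suc (suc (suc j))) (s≤s (s≤s (s≤s z≤n))) no-isolated =
  mk⇔ (λ G-critical → forward G-critical (no-isolated u)) backward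
  where open JoinGraph G u (suc j)
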